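{- Let $G$ be an edge-regular graph with parameters $(n,k,\lambda)$. Then the subdivision graph $S(G)$ is edge-regular if and only if $G$ is a disjoint union of cycles.
   Context: All graphs are finite and simple. A graph on $n$ vertices is edge-regular with parameters $(n,k,\lambda)$ if every vertex has exactly $k$ neighbours and any two adjacent vertices have exactly $\lambda$ common neighbours. The subdivision graph $S(G)$ is obtained from $G$ by replacing every edge $uv$ by a path $u\,w\,v$ through a new vertex $w$ (a distinct new vertex for each edge). -}

module Defs where

open import Data.Nat using (ℕ; zero; suc; _≤_; _<_)
open import Data.Bool using (Bool; true; false; _∧_; _∨_; if_then_else_)
open import Data.Fin using (Fin; toℕ)
open import Data.Fin.Properties using (_≟_)
open import Data.List using (List; []; _∷_; length; map; filter; concat; concatMap; allFin; zip; _++_; [_])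
open import Data.List.Membership.Propositional using (_∈_)
open import Data.List.Relation.Unary.All using (All)
open import Data.List.Relation.Unary.Any using (Any)
open import Data.List.Relation.Unary.Unique.Propositional using (Unique)
open import Data.Product using (Σ; _×_; _,_; proj₁; proj₂)
open import Data.Sum using (_⊎_; inj₁; inj₂)
open import Relation.Binary.PropositionalEquality using (_≡_)
open import Relation.Nullary.Decidable using (⌊_⌋)
open import Data.Nat.Properties using (_<?_)
open import Function.Bundles using (_⇔_)

record SimpleGraph (n : ℕ) : Set where
  field
    adj    : Fin n → Fin n → Bool
    sym    : ∀ u v → adj u v ≡ adj v u
    irrefl : ∀ v → adj v v ≡ false
open SimpleGraph public

-- A graph given by a duplicate-free list of vertices (its whole vertex set)
-- together with a Boolean adjacency relation; only adjacencies between
-- listed vertices matter.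
record ListGraph : Set₁ where
  field
    V   : Set
    vs  : List V
    adj : V → V → Bool
open ListGraph public

count : {A : Set} → (A → Bool) → List A → ℕ
count p [] = 0
count p (x ∷ xs) = if p x then suc (count p xs) else count p xs

degree : (Γ : ListGraph) → V Γ → ℕ
degree Γ u = count (λ w → adj Γ u w) (vs Γ)

commonNbrs : (Γ : ListGraph) → V Γ → V Γ → ℕ
commonNbrs Γ u v = count (λ w → adj Γ u w ∧ adj Γ v w) (vs Γ)

EdgeRegular : ListGraph → ℕ → ℕ → ℕ → Set
EdgeRegular Γ n k l =
  (length (vs Γ) ≡ n)
  × (∀ u → u ∈ vs Γ → degree Γ u ≡ k)
  × (∀ u v → u ∈ vs Γ → v ∈ vs Γ → adj Γ u v ≡ true → commonNbrs Γ u v ≡ l)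

IsEdgeRegular : ListGraph → Set
IsEdgeRegular Γ = Σ ℕ λ n → Σ ℕ λ k → Σ ℕ λ l → EdgeRegular Γ n k l

toListGraph : ∀ {n} → SimpleGraph n → ListGraph
toListGraph {n} G = record { V = Fin n ; vs = allFin n ; adj = adj G }

eqF : ∀ {n} → Fin n → Fin n → Bool
eqF i j = ⌊ i ≟ j ⌋

edgeList : ∀ {n} → SimpleGraph n → List (Fin n × Fin n)
edgeList {n} G =
  concatMap (λ i → concatMap (λ j →
     if ⌊ toℕ i <? toℕ j ⌋ ∧ adj G i j then [ (i , j) ] else []) (allFin n)) (allFin n)

-- Subdivision graph S(G): original vertices plus one new vertex per edge;
-- the new vertex of edge {i,j} is adjacent exactly to i and j.
sAdj : ∀ {n} → (Fin n ⊎ (Fin n × Fin n)) → (Fin n ⊎ (Fin n × Fin n)) → Bool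
sAdj (inj₁ v) (inj₁ w) = false
sAdj (inj₁ v) (inj₂ (i , j)) = eqF v i ∨ eqF v j
sAdj (inj₂ (i , j)) (inj₁ v) = eqF v i ∨ eqF v j
sAdj (inj₂ e) (inj₂ f) = false

subdivision : ∀ {n} → SimpleGraph n → ListGraph
subdivision {n} G = record
  { V = Fin n ⊎ (Fin n × Fin n)
  ; vs = map inj₁ (allFin n) ++ map inj₂ (edgeList G)
  ; adj = sAdj }

cycPairs : {A : Set} → List A → List (A × A)
cycPairs [] = []
cycPairs (x ∷ xs) = zip (x ∷ xs) (xs ++ [ x ])

CycAdj : ∀ {n} → List (Fin n) → Fin n → Fin n → Set
CycAdj c u v = ((u , v) ∈ cycPairs c) ⊎ ((v , u) ∈ cycPairs c)

-- G is a disjoint union of cycles: its vertex set is partitioned into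
-- cyclic sequences of length ≥ 3 of distinct vertices, and two vertices are
-- adjacent iff they are consecutive in one of these cycles.
IsDisjointUnionOfCycles : ∀ {n} → SimpleGraph n → Set
IsDisjointUnionOfCycles {n} G =
  Σ (List (List (Fin n))) λ cs →
    All (λ c → 3 ≤ length c) cs
    × Unique (concat cs)
    × (∀ v → v ∈ concat cs)
    × (∀ u v → (adj G u v ≡ true) ⇔ Any (λ c → CycAdj c u v) cs)

-- S(G) is bipartite, so adjacent vertices of S(G) have no common neighbour; an original vertex
-- keeps its degree k and a subdivision vertex has degree 2. As k > 0, every original vertex is
-- next to a subdivision vertex, so S(G) is edge-regular exactly when k = 2.
-- A 2-regular graph is a disjoint union of cycles: the walk from a vertex that never turns back
-- first revisits a vertex at its start (a revisit anywhere else would give that vertex three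
-- neighbours), and deleting this cycle leaves a smaller vertex set closed under adjacency.
-- Conversely, in a disjoint union of cycles the middle one of three consecutive vertices of a
-- cycle has degree 2, so k = 2.

module Submission where

open import Defs hiding (sym)
open import Data.Nat using (ℕ; _<_; zero; suc; _+_; _*_; _≤_; z≤n; s≤s)
open import Function.Bundles using (_⇔_; mk⇔; Equivalence)

open import Data.Bool using (Bool; true; false; _∧_; _∨_; if_then_else_)
open import Data.Bool.Properties using (∧-zeroʳ; ∧-comm; ∨-zeroʳ; not-¬; ¬-not)
open import Data.Empty using (⊥; ⊥-elim)
open import Data.Fin using (Fin; toℕ)
open import Data.Fin.Properties using (_≟_; toℕ-injective; toℕ<n; pigeonhole)
open import Data.List using (List; []; _∷_; length; map; concat; concatMap; allFin; zip; _++_; [_]; applyUpTo; filter)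
open import Data.List.Properties using (applyUpTo-∷ʳ; length-applyUpTo; length-tabulate; filter-notAll)
open import Data.List.Membership.Propositional using (_∈_; _∉_)
open import Data.List.Membership.Propositional.Properties
  using (∈-++⁺ˡ; ∈-++⁺ʳ; ∈-++⁻; ∈-map⁺; ∈-map⁻; ∈-concat⁺; ∈-concatMap⁻; ∈-applyUpTo⁺; ∈-applyUpTo⁻;
         ∈-allFin; ∈-filter⁺; ∈-filter⁻)
open import Data.List.Relation.Unary.All as All using (All; []; _∷_)
open import Data.List.Relation.Unary.AllPairs using ([]; _∷_)
open import Data.List.Relation.Unary.Any as Any using (Any; here; there)
open import Data.List.Relation.Unary.Unique.Propositional using (Unique)
open import Data.List.Relation.Unary.Unique.Propositional.Properties
  using (allFin⁺; ++⁺; filter⁺; Unique[x∷xs]⇒x∉xs)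
open import Data.Nat.Properties
  using (+-commutativeSemigroup; +-assoc; +-suc; +-identityʳ; *-comm; *-zeroʳ; *-identityʳ; *-distribˡ-+;
         <-irrefl; <-trans; <⇒≯; <-cmp; m≤n⇒m<n∨m≡n; ≤-pred; ≤-trans; ≤-reflexive; n<1+n; m<n⇒m<1+n;
         suc-injective; _<?_)
open import Algebra.Properties.CommutativeSemigroup +-commutativeSemigroup using (interchange)
open import Data.Product using (∃; _×_; _,_; proj₁; proj₂)
open import Data.Sum using (_⊎_; inj₁; inj₂)
open import Function using (_∘_)
open import Relation.Binary using (tri<; tri≈; tri>)
open import Relation.Binary.PropositionalEquality
  using (_≡_; _≢_; refl; sym; trans; cong; cong₂; subst; module ≡-Reasoning)
open import Relation.Nullary using (¬_; Dec; yes; no)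
open import Relation.Nullary.Decidable using (⌊_⌋; ¬?; dec-true; dec-false; isYes≗does)

private
  variable
    A B : Set

isYes-true : ∀ {P : Set} (P? : Dec P) → P → ⌊ P? ⌋ ≡ true
isYes-true P? p = trans (isYes≗does P?) (dec-true P? p)

isYes-false : ∀ {P : Set} (P? : Dec P) → ¬ P → ⌊ P? ⌋ ≡ false
isYes-false P? ¬p = trans (isYes≗does P?) (dec-false P? ¬p)

isYes⇒ : ∀ {P : Set} {P? : Dec P} → ⌊ P? ⌋ ≡ true → P
isYes⇒ {P? = yes p} _ = p

∧≡true⁻ : ∀ {a b} → a ∧ b ≡ true → a ≡ true × b ≡ true
∧≡true⁻ {true} {true} _ = refl , refl

∨≡true⁻ : ∀ {a b} → a ∨ b ≡ true → a ≡ true ⊎ b ≡ true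
∨≡true⁻ {true}  _ = inj₁ refl
∨≡true⁻ {false} e = inj₂ e

eqF-refl : ∀ {n} (v : Fin n) → eqF v v ≡ true
eqF-refl v = isYes-true (v ≟ v) refl

eqF⇒≡ : ∀ {n} {v w : Fin n} → eqF v w ≡ true → v ≡ w
eqF⇒≡ {v = v} {w} = isYes⇒ {P? = v ≟ w}

𝟙 : Bool → ℕ
𝟙 true  = 1
𝟙 false = 0

∑ : List A → (A → ℕ) → ℕ
∑ []       f = 0
∑ (x ∷ xs) f = f x + ∑ xs f

syntax ∑ xs (λ x → e) = ∑[ x ∈ xs ] e

∑-cong : ∀ (xs : List A) {f g : A → ℕ} → (∀ x → f x ≡ g x) → ∑ xs f ≡ ∑ xs g
∑-cong []       eq = refl
∑-cong (x ∷ xs) eq = cong₂ _+_ (eq x) (∑-cong xs eq)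

∑-++ : ∀ (xs ys : List A) (f : A → ℕ) → ∑ (xs ++ ys) f ≡ ∑ xs f + ∑ ys f
∑-++ []       ys f = refl
∑-++ (x ∷ xs) ys f = trans (cong (f x +_) (∑-++ xs ys f)) (sym (+-assoc (f x) _ _))

∑-concatMap : ∀ (g : A → List B) (xs : List A) (f : B → ℕ) →
              ∑ (concatMap g xs) f ≡ ∑[ x ∈ xs ] ∑ (g x) f
∑-concatMap g []       f = refl
∑-concatMap g (x ∷ xs) f = trans (∑-++ (g x) (concatMap g xs) f) (cong (∑ (g x) f +_) (∑-concatMap g xs f))

∑-+ : ∀ (xs : List A) (f g : A → ℕ) → ∑[ x ∈ xs ] (f x + g x) ≡ ∑ xs f + ∑ xs g
∑-+ []       f g = refl
∑-+ (x ∷ xs) f g =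
  trans (cong (f x + g x +_) (∑-+ xs f g)) (interchange (f x) (g x) (∑ xs f) (∑ xs g))

∑-*ˡ : ∀ (xs : List A) (c : ℕ) (f : A → ℕ) → ∑[ x ∈ xs ] (c * f x) ≡ c * ∑ xs f
∑-*ˡ []       c f = sym (*-zeroʳ c)
∑-*ˡ (x ∷ xs) c f = trans (cong (c * f x +_) (∑-*ˡ xs c f)) (sym (*-distribˡ-+ c (f x) (∑ xs f)))

∑-if : ∀ (b : Bool) (x : A) (f : A → ℕ) → ∑ (if b then [ x ] else []) f ≡ 𝟙 b * f x
∑-if true  x f = refl
∑-if false x f = refl

module _ (p : A → Bool) where

  count-++ : ∀ xs ys → count p (xs ++ ys) ≡ count p xs + count p ys
  count-++ []       ys = refl
  count-++ (x ∷ xs) ys with p x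
  ... | true  = cong suc (count-++ xs ys)
  ... | false = count-++ xs ys

  count≡∑ : ∀ xs → count p xs ≡ ∑[ x ∈ xs ] 𝟙 (p x)
  count≡∑ []       = refl
  count≡∑ (x ∷ xs) with p x
  ... | true  = cong suc (count≡∑ xs)
  ... | false = count≡∑ xs

count-map : (p : B → Bool) (f : A → B) (xs : List A) → count p (map f xs) ≡ count (p ∘ f) xs
count-map p f []       = refl
count-map p f (x ∷ xs) with p (f x)
... | true  = cong suc (count-map p f xs)
... | false = count-map p f xs

record ExactlyOne (p : A → Bool) (xs : List A) : Set where
  field
    a    : A
    a∈   : a ∈ xs
    pa   : p a ≡ true
    only : ∀ {w} → w ∈ xs → p w ≡ true → w ≡ a

record ExactlyTwo (p : A → Bool) (xs : List A) : Set where
  field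
    a b  : A
    a∈   : a ∈ xs
    b∈   : b ∈ xs
    a≢b  : a ≢ b
    pa   : p a ≡ true
    pb   : p b ≡ true
    only : ∀ {w} → w ∈ xs → p w ≡ true → w ≡ a ⊎ w ≡ b

module _ {p : A → Bool} where

  count≡0⁺ : ∀ xs → (∀ {w} → w ∈ xs → p w ≡ false) → count p xs ≡ 0
  count≡0⁺ []       _   = refl
  count≡0⁺ (x ∷ xs) pxs rewrite pxs (here refl) = count≡0⁺ xs (pxs ∘ there)

  count≡0⁻ : ∀ {xs w} → count p xs ≡ 0 → w ∈ xs → p w ≡ false
  count≡0⁻ {x ∷ xs} c w∈ with p x in px
  count≡0⁻ {x ∷ xs} () w∈          | true
  count≡0⁻ {x ∷ xs} c (here refl)  | false = px
  count≡0⁻ {x ∷ xs} c (there w∈)   | false = count≡0⁻ c w∈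

  count>0⇒∃ : ∀ {xs} → 0 < count p xs → ∃ λ x → x ∈ xs × p x ≡ true
  count>0⇒∃ {x ∷ xs} c with p x in px
  ... | true  = x , here refl , px
  ... | false with count>0⇒∃ c
  ...   | y , y∈ , py = y , there y∈ , py

  private
    rejected : ∀ {x y} → p x ≡ false → p y ≡ true → y ≢ x
    rejected px py refl = not-¬ px py

  module _ {x : A} {xs : List A} (px : p x ≡ false) where

    ExactlyOne-∷ : ExactlyOne p xs → ExactlyOne p (x ∷ xs)
    ExactlyOne-∷ e = record
      { a = a ; a∈ = there a∈ ; pa = pa
      ; only = λ { (here refl) pw → ⊥-elim (not-¬ px pw) ; (there w∈) pw → only w∈ pw } }
      where open ExactlyOne e

    ExactlyOne-tail : ExactlyOne p (x ∷ xs) → ExactlyOne p xs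
    ExactlyOne-tail e = record
      { a = a ; a∈ = Any.tail (rejected px pa) a∈ ; pa = pa ; only = only ∘ there }
      where open ExactlyOne e

    ExactlyTwo-∷ : ExactlyTwo p xs → ExactlyTwo p (x ∷ xs)
    ExactlyTwo-∷ t = record
      { a = a ; b = b ; a∈ = there a∈ ; b∈ = there b∈ ; a≢b = a≢b ; pa = pa ; pb = pb
      ; only = λ { (here refl) pw → ⊥-elim (not-¬ px pw) ; (there w∈) pw → only w∈ pw } }
      where open ExactlyTwo t

    ExactlyTwo-tail : ExactlyTwo p (x ∷ xs) → ExactlyTwo p xs
    ExactlyTwo-tail t = record
      { a = a ; b = b ; a∈ = Any.tail (rejected px pa) a∈ ; b∈ = Any.tail (rejected px pb) b∈
      ; a≢b = a≢b ; pa = pa ; pb = pb ; only = only ∘ there }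
      where open ExactlyTwo t

  ExactlyTwo-swap : ∀ {xs} → ExactlyTwo p xs → ExactlyTwo p xs
  ExactlyTwo-swap t = record
    { a = b ; b = a ; a∈ = b∈ ; b∈ = a∈ ; a≢b = a≢b ∘ sym ; pa = pb ; pb = pa
    ; only = λ w∈ pw → Data.Sum.swap (only w∈ pw) }
    where open ExactlyTwo t

  ExactlyTwo-dropFirst : ∀ {x xs} → x ∉ xs → (t : ExactlyTwo p (x ∷ xs)) → x ≡ ExactlyTwo.a t → ExactlyOne p xs
  ExactlyTwo-dropFirst x∉ t refl = record
    { a = b ; a∈ = Any.tail (a≢b ∘ sym) b∈ ; pa = pb
    ; only = λ w∈ pw → Data.Sum.fromInj₂ (λ { refl → ⊥-elim (x∉ w∈) }) (only (there w∈) pw) }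
    where open ExactlyTwo t

  count≡1⁺ : ∀ {xs} → Unique xs → ExactlyOne p xs → count p xs ≡ 1
  count≡1⁺ {x ∷ xs} (x∉ ∷ u) e with p x in px
  ... | true  = cong suc (count≡0⁺ xs λ w∈ → ¬-not λ pw → All.lookup x∉ w∈ (trans (x≡a px) (sym (w≡a w∈ pw))))
    where
    open ExactlyOne e
    x≡a : p x ≡ true → x ≡ a
    x≡a = only (here refl)
    w≡a : ∀ {w} → w ∈ xs → p w ≡ true → w ≡ a
    w≡a = only ∘ there
  ... | false = count≡1⁺ u (ExactlyOne-tail px e)

  count≡1⁻ : ∀ {xs} → count p xs ≡ 1 → ExactlyOne p xs
  count≡1⁻ {x ∷ xs} c with p x in px
  ... | true  = record
    { a = x ; a∈ = here refl ; pa = px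
    ; only = λ { (here refl) _ → refl ; (there w∈) pw → ⊥-elim (not-¬ (count≡0⁻ (suc-injective c) w∈) pw) } }
  ... | false = ExactlyOne-∷ px (count≡1⁻ c)

  count≡2⁺ : ∀ {xs} → Unique xs → ExactlyTwo p xs → count p xs ≡ 2
  count≡2⁺ {x ∷ xs} u@(_ ∷ u′) t with p x in px
  ... | true with ExactlyTwo.only t (here refl) px
  ...   | inj₁ x≡a = cong suc (count≡1⁺ u′ (ExactlyTwo-dropFirst (Unique[x∷xs]⇒x∉xs u) t x≡a))
  ...   | inj₂ x≡b = cong suc (count≡1⁺ u′ (ExactlyTwo-dropFirst (Unique[x∷xs]⇒x∉xs u) (ExactlyTwo-swap t) x≡b))
  count≡2⁺ {x ∷ xs} (_ ∷ u′) t | false = count≡2⁺ u′ (ExactlyTwo-tail px t)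

  count≡2⁻ : ∀ {xs} → Unique xs → count p xs ≡ 2 → ExactlyTwo p xs
  count≡2⁻ {x ∷ xs} (x∉ ∷ u) c with p x in px
  ... | true  = record
    { a = x ; b = a ; a∈ = here refl ; b∈ = there a∈ ; a≢b = All.lookup x∉ a∈ ; pa = px ; pb = pa
    ; only = λ { (here refl) _ → inj₁ refl ; (there w∈) pw → inj₂ (only w∈ pw) } }
    where open ExactlyOne (count≡1⁻ {xs} (suc-injective c))
  ... | false = ExactlyTwo-∷ px (count≡2⁻ u c)

∑-δ : ∀ {n} (v : Fin n) (f : Fin n → ℕ) → ∑[ w ∈ allFin n ] (𝟙 (eqF v w) * f w) ≡ f v
∑-δ {n} v f = begin
  ∑[ w ∈ allFin n ] (𝟙 (eqF v w) * f w)  ≡⟨ ∑-cong (allFin n) sift ⟩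
  ∑[ w ∈ allFin n ] (f v * 𝟙 (eqF v w))  ≡⟨ ∑-*ˡ (allFin n) (f v) (𝟙 ∘ eqF v) ⟩
  f v * ∑[ w ∈ allFin n ] 𝟙 (eqF v w)    ≡⟨ cong (f v *_) (sym (count≡∑ (eqF v) (allFin n))) ⟩
  f v * count (eqF v) (allFin n)         ≡⟨ cong (f v *_) (count≡1⁺ (allFin⁺ n) onlyV) ⟩
  f v * 1                                ≡⟨ *-identityʳ (f v) ⟩
  f v                                    ∎
  where
  open ≡-Reasoning
  sift : ∀ w → 𝟙 (eqF v w) * f w ≡ f v * 𝟙 (eqF v w)
  sift w with v ≟ w
  ... | yes refl = *-comm 1 (f v)
  ... | no _     = sym (*-zeroʳ (f v))
  onlyV : ExactlyOne (eqF v) (allFin n)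
  onlyV = record { a = v ; a∈ = ∈-allFin v ; pa = eqF-refl v ; only = λ _ e → sym (eqF⇒≡ e) }

∈-if⁻ : ∀ {x y : A} b → y ∈ (if b then [ x ] else []) → b ≡ true × y ≡ x
∈-if⁻ true (here y≡x) = refl , y≡x

applyUpTo⁻₁ : ∀ (f : ℕ → A) n → Unique (applyUpTo f n) → ∀ {i j} → i < j → j < n → f i ≢ f j
applyUpTo⁻₁ f (suc n) (f₀∉ ∷ _) {zero}  {suc j} _         (s≤s j<n) = All.lookup f₀∉ (∈-applyUpTo⁺ (f ∘ suc) j<n)
applyUpTo⁻₁ f (suc n) (_ ∷ u)   {suc i} {suc j} (s≤s i<j) (s≤s j<n) = applyUpTo⁻₁ (f ∘ suc) n u i<j j<n

applyUpTo-¬Unique : ∀ {n m} (f : ℕ → Fin n) → n < m → ¬ Unique (applyUpTo f m)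
applyUpTo-¬Unique f n<m u with pigeonhole n<m (f ∘ toℕ)
... | i , j , i<j , fi≡fj = applyUpTo⁻₁ f _ u i<j (toℕ<n j) fi≡fj

firstRepeat : ∀ {n} (f : ℕ → Fin n) → ∃ λ m → Unique (applyUpTo f m) × f m ∈ applyUpTo f m
firstRepeat {n} f = search (suc n) 0 (+-identityʳ (suc n)) []
  where
  search : ∀ k m → k + m ≡ suc n → Unique (applyUpTo f m) → ∃ λ m → Unique (applyUpTo f m) × f m ∈ applyUpTo f m
  search zero    m refl u = ⊥-elim (applyUpTo-¬Unique f (n<1+n n) u)
  search (suc k) m k+m≡ u with Any.any? (f m ≟_) (applyUpTo f m)
  ... | yes r = m , u , r
  ... | no  r = search k (suc m) (trans (+-suc k m) k+m≡)
                  (subst Unique (applyUpTo-∷ʳ f m) (++⁺ u ([] ∷ []) λ { (fm∈ , here refl) → r fm∈ }))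

zip-applyUpTo : ∀ (f : ℕ → A) (g : ℕ → B) n → zip (applyUpTo f n) (applyUpTo g n) ≡ applyUpTo (λ t → f t , g t) n
zip-applyUpTo f g zero    = refl
zip-applyUpTo f g (suc n) = cong ((f 0 , g 0) ∷_) (zip-applyUpTo (f ∘ suc) (g ∘ suc) n)

cycPairs-applyUpTo : ∀ (f : ℕ → A) k → f (suc k) ≡ f 0 →
  cycPairs (applyUpTo f (suc k)) ≡ applyUpTo (λ t → f t , f (suc t)) (suc k)
cycPairs-applyUpTo f k closes = begin
  zip (applyUpTo f (suc k)) (applyUpTo (f ∘ suc) k ++ [ f 0 ])
    ≡⟨ cong (λ z → zip (applyUpTo f (suc k)) (applyUpTo (f ∘ suc) k ++ [ z ])) (sym closes) ⟩
  zip (applyUpTo f (suc k)) (applyUpTo (f ∘ suc) k ++ [ f (suc k) ])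
    ≡⟨ cong (zip (applyUpTo f (suc k))) (applyUpTo-∷ʳ (f ∘ suc) k) ⟩
  zip (applyUpTo f (suc k)) (applyUpTo (f ∘ suc) (suc k))
    ≡⟨ zip-applyUpTo f (f ∘ suc) (suc k) ⟩
  applyUpTo (λ t → f t , f (suc t)) (suc k) ∎
  where open ≡-Reasoning

∈-zip⁻ : ∀ {xs : List A} {ys : List B} {a b} → (a , b) ∈ zip xs ys → a ∈ xs × b ∈ ys
∈-zip⁻ {xs = _ ∷ _} {_ ∷ _} (here refl) = here refl , here refl
∈-zip⁻ {xs = _ ∷ _} {_ ∷ _} (there ab∈) = Data.Product.map there there (∈-zip⁻ ab∈)

cycPairs⇒∈ : ∀ {c : List A} {a b} → (a , b) ∈ cycPairs c → a ∈ c × b ∈ c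
cycPairs⇒∈ {c = x ∷ xs} ab∈ with ∈-zip⁻ ab∈
... | a∈ , b∈ with ∈-++⁻ xs b∈
...   | inj₁ b∈xs        = a∈ , there b∈xs
...   | inj₂ (here refl) = a∈ , here refl

CycAdj⇒∈ : ∀ {n} {c : List (Fin n)} {u w} → CycAdj c u w → u ∈ c × w ∈ c
CycAdj⇒∈ (inj₁ uw∈) = cycPairs⇒∈ uw∈
CycAdj⇒∈ (inj₂ wu∈) = Data.Product.swap (cycPairs⇒∈ wu∈)

-- Degrees in the subdivision graph

module _ {n : ℕ} (G : SimpleGraph n) where

  adj-sym : ∀ {u w} → adj G u w ≡ true → adj G w u ≡ true
  adj-sym {u} {w} = trans (SimpleGraph.sym G w u)

  adj⇒≢ : ∀ {u w} → adj G u w ≡ true → u ≢ w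
  adj⇒≢ {u} e refl = not-¬ (irrefl G u) e

  isEdge : Fin n → Fin n → Bool
  isEdge i j = ⌊ toℕ i <? toℕ j ⌋ ∧ adj G i j

  isEdge-irrefl : ∀ v → isEdge v v ≡ false
  isEdge-irrefl v = cong (_∧ adj G v v) (isYes-false (toℕ v <? toℕ v) (<-irrefl refl))

  isEdge-either : ∀ v w → 𝟙 (isEdge v w) + 𝟙 (isEdge w v) ≡ 𝟙 (adj G v w)
  isEdge-either v w with <-cmp (toℕ v) (toℕ w)
  ... | tri< v<w _ _
    rewrite isYes-true (toℕ v <? toℕ w) v<w | isYes-false (toℕ w <? toℕ v) (<⇒≯ v<w) = +-identityʳ _
  ... | tri> _ _ w<v
    rewrite isYes-true (toℕ w <? toℕ v) w<v | isYes-false (toℕ v <? toℕ w) (<⇒≯ w<v) =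
      cong 𝟙 (SimpleGraph.sym G w v)
  ... | tri≈ _ v≡w _ rewrite toℕ-injective v≡w | isEdge-irrefl w = cong 𝟙 (sym (irrefl G w))

  isEdge-incident : ∀ v i j →
    𝟙 (isEdge i j) * 𝟙 (eqF v i ∨ eqF v j) ≡ 𝟙 (eqF v i) * 𝟙 (isEdge v j) + 𝟙 (eqF v j) * 𝟙 (isEdge i v)
  isEdge-incident v i j with v ≟ i | v ≟ j
  ... | yes refl | yes refl rewrite isEdge-irrefl v = refl
  ... | yes refl | no _ with isEdge v j
  ...   | true  = refl
  ...   | false = refl
  isEdge-incident v i j | no _ | yes refl with isEdge i v
  ...   | true  = refl
  ...   | false = refl
  isEdge-incident v i j | no _ | no _ = *-zeroʳ (𝟙 (isEdge i j))

  ∑-edgeList : ∀ (f : Fin n × Fin n → ℕ) →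
    ∑ (edgeList G) f ≡ ∑[ i ∈ allFin n ] ∑[ j ∈ allFin n ] (𝟙 (isEdge i j) * f (i , j))
  ∑-edgeList f = trans (∑-concatMap _ (allFin n) f) (∑-cong (allFin n) λ i →
                 trans (∑-concatMap _ (allFin n) f) (∑-cong (allFin n) λ j → ∑-if (isEdge i j) (i , j) f))

  ∈-edgeList⁻ : ∀ {i j} → (i , j) ∈ edgeList G → isEdge i j ≡ true
  ∈-edgeList⁻ e∈ with Any.satisfied (∈-concatMap⁻ _ {xs = allFin n} e∈)
  ... | i , e∈ᵢ with Any.satisfied (∈-concatMap⁻ _ {xs = allFin n} e∈ᵢ)
  ... | j , e∈ᵢⱼ with ∈-if⁻ (isEdge i j) e∈ᵢⱼ
  ...   | isEdgeᵢⱼ , refl = isEdgeᵢⱼ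

  incidentEdges≡degree : ∀ v → count (λ e → sAdj (inj₁ v) (inj₂ e)) (edgeList G) ≡ count (adj G v) (allFin n)
  incidentEdges≡degree v = begin
    count (λ e → sAdj (inj₁ v) (inj₂ e)) (edgeList G)
      ≡⟨ count≡∑ _ (edgeList G) ⟩
    ∑[ e ∈ edgeList G ] 𝟙 (sAdj (inj₁ v) (inj₂ e))
      ≡⟨ ∑-edgeList _ ⟩
    ∑[ i ∈ allFin n ] ∑[ j ∈ allFin n ] (𝟙 (isEdge i j) * 𝟙 (eqF v i ∨ eqF v j))
      ≡⟨ ∑-cong (allFin n) (λ i → ∑-cong (allFin n) (isEdge-incident v i)) ⟩
    ∑[ i ∈ allFin n ] ∑[ j ∈ allFin n ] (𝟙 (eqF v i) * 𝟙 (isEdge v j) + 𝟙 (eqF v j) * 𝟙 (isEdge i v))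
      ≡⟨ ∑-cong (allFin n) (λ i → trans (∑-+ (allFin n) _ _)
           (cong₂ _+_ (∑-*ˡ (allFin n) (𝟙 (eqF v i)) _) (∑-δ v (λ _ → 𝟙 (isEdge i v))))) ⟩
    ∑[ i ∈ allFin n ] (𝟙 (eqF v i) * out + 𝟙 (isEdge i v))
      ≡⟨ ∑-+ (allFin n) _ _ ⟩
    ∑[ i ∈ allFin n ] (𝟙 (eqF v i) * out) + inn
      ≡⟨ cong (_+ inn) (∑-δ v (λ _ → out)) ⟩
    out + inn
      ≡⟨ sym (∑-+ (allFin n) _ _) ⟩
    ∑[ w ∈ allFin n ] (𝟙 (isEdge v w) + 𝟙 (isEdge w v))
      ≡⟨ ∑-cong (allFin n) (isEdge-either v) ⟩
    ∑[ w ∈ allFin n ] 𝟙 (adj G v w)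
      ≡⟨ sym (count≡∑ (adj G v) (allFin n)) ⟩
    count (adj G v) (allFin n) ∎
    where
    open ≡-Reasoning
    out inn : ℕ
    out = ∑[ w ∈ allFin n ] 𝟙 (isEdge v w)
    inn = ∑[ w ∈ allFin n ] 𝟙 (isEdge w v)

  degree-inj₁ : ∀ v → degree (subdivision G) (inj₁ v) ≡ degree (toListGraph G) v
  degree-inj₁ v = begin
    count p (map inj₁ (allFin n) ++ map inj₂ (edgeList G))
      ≡⟨ count-++ p (map inj₁ (allFin n)) _ ⟩
    count p (map inj₁ (allFin n)) + count p (map inj₂ (edgeList G))
      ≡⟨ cong₂ _+_ (trans (count-map p inj₁ (allFin n)) (count≡0⁺ (allFin n) λ _ → refl))
                   (count-map p inj₂ (edgeList G)) ⟩
    count (λ e → p (inj₂ e)) (edgeList G)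
      ≡⟨ incidentEdges≡degree v ⟩
    count (adj G v) (allFin n) ∎
    where
    open ≡-Reasoning
    p = sAdj (inj₁ v)

  degree-inj₂ : ∀ {i j} → (i , j) ∈ edgeList G → degree (subdivision G) (inj₂ (i , j)) ≡ 2
  degree-inj₂ {i} {j} e∈ = begin
    count p (map inj₁ (allFin n) ++ map inj₂ (edgeList G))
      ≡⟨ count-++ p (map inj₁ (allFin n)) _ ⟩
    count p (map inj₁ (allFin n)) + count p (map inj₂ (edgeList G))
      ≡⟨ cong₂ _+_ (count-map p inj₁ (allFin n))
                   (trans (count-map p inj₂ (edgeList G)) (count≡0⁺ (edgeList G) λ _ → refl)) ⟩
    count (λ w → eqF w i ∨ eqF w j) (allFin n) + 0
      ≡⟨ +-identityʳ _ ⟩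
    count (λ w → eqF w i ∨ eqF w j) (allFin n)
      ≡⟨ count≡2⁺ (allFin⁺ n) endpoints ⟩
    2 ∎
    where
    open ≡-Reasoning
    p = sAdj (inj₂ (i , j))
    endpoints : ExactlyTwo (λ w → eqF w i ∨ eqF w j) (allFin n)
    endpoints = record
      { a = i ; b = j ; a∈ = ∈-allFin i ; b∈ = ∈-allFin j
      ; a≢b = adj⇒≢ (proj₂ (∧≡true⁻ (∈-edgeList⁻ e∈)))
      ; pa = cong (_∨ eqF i j) (eqF-refl i)
      ; pb = trans (cong (eqF j i ∨_) (eqF-refl j)) (∨-zeroʳ (eqF j i))
      ; only = λ _ e → Data.Sum.map eqF⇒≡ eqF⇒≡ (∨≡true⁻ e) }

  subdivision-bipartite : ∀ (a : Fin n) e x → sAdj (inj₁ a) x ∧ sAdj (inj₂ e) x ≡ false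
  subdivision-bipartite a e (inj₁ _) = refl
  subdivision-bipartite a e (inj₂ _) = ∧-zeroʳ _

  commonNbrs-subdivision : ∀ u w → sAdj u w ≡ true → commonNbrs (subdivision G) u w ≡ 0
  commonNbrs-subdivision (inj₁ a) (inj₂ e) _ =
    count≡0⁺ (vs (subdivision G)) λ {x} _ → subdivision-bipartite a e x
  commonNbrs-subdivision (inj₂ e) (inj₁ a) _ =
    count≡0⁺ (vs (subdivision G)) λ {x} _ →
      trans (∧-comm (sAdj (inj₂ e) x) (sAdj (inj₁ a) x)) (subdivision-bipartite a e x)

-- Two-regular graphs are disjoint unions of cycles

IsTwoRegular : ∀ {n} → SimpleGraph n → Set
IsTwoRegular {n} G = ∀ (v : Fin n) → degree (toListGraph G) v ≡ 2

module TwoRegular {n : ℕ} (G : SimpleGraph n) (twoRegular : IsTwoRegular G) where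

  private
    module N v = ExactlyTwo (count≡2⁻ (allFin⁺ n) (twoRegular v))

  neighbours≡ : ∀ {v a b w} → adj G v a ≡ true → adj G v b ≡ true → a ≢ b → adj G v w ≡ true → w ≡ a ⊎ w ≡ b
  neighbours≡ {v} {a} {b} {w} va vb a≢b vw
    with N.only v (∈-allFin a) va | N.only v (∈-allFin b) vb | N.only v (∈-allFin w) vw
  ... | inj₁ refl | inj₁ refl | _   = ⊥-elim (a≢b refl)
  ... | inj₂ refl | inj₂ refl | _   = ⊥-elim (a≢b refl)
  ... | inj₁ refl | inj₂ refl | w≡  = w≡
  ... | inj₂ refl | inj₁ refl | w≡  = Data.Sum.swap w≡

  noThreeNeighbours : ∀ {v a b c} → adj G v a ≡ true → adj G v b ≡ true → adj G v c ≡ true →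
                      a ≢ b → a ≢ c → b ≢ c → ⊥
  noThreeNeighbours va vb vc a≢b a≢c b≢c with neighbours≡ va vb a≢b vc
  ... | inj₁ c≡a = a≢c (sym c≡a)
  ... | inj₂ c≡b = b≢c (sym c≡b)

  other : Fin n → Fin n → Fin n
  other c p with p ≟ N.a c
  ... | yes _ = N.b c
  ... | no  _ = N.a c

  other-adj : ∀ c p → adj G c (other c p) ≡ true
  other-adj c p with p ≟ N.a c
  ... | yes _ = N.pb c
  ... | no  _ = N.pa c

  other-≢ : ∀ c p → other c p ≢ p
  other-≢ c p with p ≟ N.a c
  ... | yes p≡a = λ b≡p → N.a≢b c (trans (sym p≡a) (sym b≡p))
  ... | no  p≢a = λ a≡p → p≢a (sym a≡p)

  dart : Fin n → ℕ → Fin n × Fin n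
  dart v zero    = v , N.a v
  dart v (suc t) = proj₂ (dart v t) , other (proj₂ (dart v t)) (proj₁ (dart v t))

  walk : Fin n → ℕ → Fin n
  walk v t = proj₁ (dart v t)

  walk-adj : ∀ v t → adj G (walk v t) (walk v (suc t)) ≡ true
  walk-adj v zero    = N.pa v
  walk-adj v (suc t) = other-adj (walk v (suc t)) (walk v t)

  walk-nonbacktracking : ∀ v t → walk v (suc (suc t)) ≢ walk v t
  walk-nonbacktracking v t = other-≢ (walk v (suc t)) (walk v t)

  walk-closes : ∀ v m → Unique (applyUpTo (walk v) m) → ∀ {j} → j < m → walk v m ≡ walk v j →
                3 ≤ m × walk v m ≡ walk v 0
  walk-closes v (suc zero)             _ {zero} _ e = ⊥-elim (adj⇒≢ G (walk-adj v 0) (sym e))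
  walk-closes v (suc (suc zero))       _ {zero} _ e = ⊥-elim (walk-nonbacktracking v 0 e)
  walk-closes v (suc (suc (suc _)))    _ {zero} _ e = s≤s (s≤s (s≤s z≤n)) , e
  walk-closes v (suc m) unique {suc j} (s≤s J≤m) e with m≤n⇒m<n∨m≡n J≤m
  ... | inj₂ refl = ⊥-elim (adj⇒≢ G (walk-adj v (suc j)) (sym e))
  ... | inj₁ J<m  = ⊥-elim (noThreeNeighbours (adj-sym G (walk-adj v j)) (walk-adj v J) Jm
                              (λ q → walk-nonbacktracking v j (sym q))
                              (distinct (<-trans (n<1+n j) J<m) (n<1+n m))
                              sJ≢m)
    where
    J = suc j
    x = walk v
    distinct = applyUpTo⁻₁ x (suc m) unique
    Jm : adj G (x J) (x m) ≡ true
    Jm = adj-sym G (subst (λ z → adj G (x m) z ≡ true) e (walk-adj v m))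
    sJ≢m : x (suc J) ≢ x m
    sJ≢m with m≤n⇒m<n∨m≡n J<m
    ... | inj₁ sJ<m = distinct sJ<m (n<1+n m)
    ... | inj₂ refl = λ _ → walk-nonbacktracking v J e

  Closed : List (Fin n) → Set
  Closed R = ∀ {u w} → u ∈ R → adj G u w ≡ true → w ∈ R

  record CycleThrough (v : Fin n) : Set where
    field
      cycle    : List (Fin n)
      long     : 3 ≤ length cycle
      distinct : Unique cycle
      start    : v ∈ cycle
      within   : ∀ {R} → Closed R → v ∈ R → ∀ {u} → u ∈ cycle → u ∈ R
      adj⇔     : ∀ {u} → u ∈ cycle → ∀ w → (adj G u w ≡ true) ⇔ CycAdj cycle u w

  module ClosedWalk (v : Fin n) (k : ℕ) (unique : Unique (applyUpTo (walk v) (suc k)))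
                    (1<k : 1 < k) (closes : walk v (suc k) ≡ walk v 0) where

    x : ℕ → Fin n
    x = walk v

    step : ℕ → Fin n × Fin n
    step t = x t , x (suc t)

    C : List (Fin n)
    C = applyUpTo x (suc k)

    pair∈ : ∀ {t} → t < suc k → (x t , x (suc t)) ∈ cycPairs C
    pair∈ {t} t<m =
      subst ((x t , x (suc t)) ∈_) (sym (cycPairs-applyUpTo x k closes)) (∈-applyUpTo⁺ step t<m)

    pair⁻ : ∀ {a b} → (a , b) ∈ cycPairs C → ∃ λ t → a ≡ x t × b ≡ x (suc t)
    pair⁻ {a} {b} ab∈ with ∈-applyUpTo⁻ step (subst ((a , b) ∈_) (cycPairs-applyUpTo x k closes) ab∈)
    ... | t , _ , ab≡ = t , cong proj₁ ab≡ , cong proj₂ ab≡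

    cycAdj⇒adj : ∀ {a b} → CycAdj C a b → adj G a b ≡ true
    cycAdj⇒adj (inj₁ ab∈) with pair⁻ ab∈
    ... | t , refl , refl = walk-adj v t
    cycAdj⇒adj (inj₂ ba∈) with pair⁻ ba∈
    ... | t , refl , refl = adj-sym G (walk-adj v t)

    predecessor : ∀ {i} → i < suc k → ∃ λ p → p < suc k × x (suc p) ≡ x i × x p ≢ x (suc i)
    predecessor {zero}  _         = k , n<1+n k , closes , λ q → applyUpTo⁻₁ x (suc k) unique 1<k (n<1+n k) (sym q)
    predecessor {suc i} (s≤s i<k) = i , m<n⇒m<1+n i<k , refl , λ q → walk-nonbacktracking v i (sym q)

    adj⇒cycAdj : ∀ {i} → i < suc k → ∀ {w} → adj G (x i) w ≡ true → CycAdj C (x i) w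
    adj⇒cycAdj {i} i<m xw with predecessor i<m
    ... | p , p<m , next≡ , p≢ with neighbours≡ (walk-adj v i) (subst (λ z → adj G z (x p) ≡ true) next≡ ip) (p≢ ∘ sym) xw
      where ip = adj-sym G (walk-adj v p)
    ...   | inj₁ refl = inj₁ (pair∈ i<m)
    ...   | inj₂ refl = inj₂ (subst (λ z → (x p , z) ∈ cycPairs C) next≡ (pair∈ p<m))

    toCycle : CycleThrough v
    toCycle = record
      { cycle    = C
      ; long     = subst (3 ≤_) (sym (length-applyUpTo x (suc k))) (s≤s 1<k)
      ; distinct = unique
      ; start    = here refl
      ; within   = λ closed v∈ u∈ → let (i , _ , u≡) = ∈-applyUpTo⁻ x u∈ in
                     subst (_∈ _) (sym u≡) (onWalk closed v∈ i)
      ; adj⇔     = λ u∈ w → let (i , i<m , u≡) = ∈-applyUpTo⁻ x u∈ in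
                     subst (λ z → (adj G z w ≡ true) ⇔ CycAdj C z w) (sym u≡) (mk⇔ (adj⇒cycAdj i<m) cycAdj⇒adj) }
      where
      onWalk : ∀ {R} → Closed R → v ∈ R → ∀ t → x t ∈ R
      onWalk closed v∈ zero    = v∈
      onWalk closed v∈ (suc t) = closed (onWalk closed v∈ t) (walk-adj v t)

  cycleThrough : ∀ v → CycleThrough v
  cycleThrough v with firstRepeat (walk v)
  ... | m , unique , r with ∈-applyUpTo⁻ (walk v) r
  ... | j , j<m , e with walk-closes v m unique j<m e
  ... | s≤s 2≤k , closes = ClosedWalk.toCycle v _ unique 2≤k closes

  record CycleDecomposition (R : List (Fin n)) : Set where
    field
      cycles   : List (List (Fin n))
      long     : All (λ c → 3 ≤ length c) cycles
      disjoint : Unique (concat cycles)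
      sound    : ∀ {u} → u ∈ concat cycles → u ∈ R
      complete : ∀ {u} → u ∈ R → u ∈ concat cycles
      adj⇔     : ∀ {u} → u ∈ R → ∀ w → (adj G u w ≡ true) ⇔ Any (λ c → CycAdj c u w) cycles

  module Remove {v} (Z : CycleThrough v) (R : List (Fin n)) where
    open CycleThrough Z

    offCycle? : ∀ u → Dec (u ∉ cycle)
    offCycle? u = ¬? (Any.any? (u ≟_) cycle)

    rest : List (Fin n)
    rest = filter offCycle? R

    ∈-rest⁻ : ∀ {u} → u ∈ rest → u ∈ R × u ∉ cycle
    ∈-rest⁻ = ∈-filter⁻ offCycle? {xs = R}

    ∈-rest⁺ : ∀ {u} → u ∈ R → u ∉ cycle → u ∈ rest
    ∈-rest⁺ = ∈-filter⁺ offCycle?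

    rest-shorter : v ∈ R → length rest < length R
    rest-shorter v∈ = filter-notAll offCycle? R (Any.map (λ { refl v∉ → v∉ start }) v∈)

    cycle-closed : ∀ {u w} → u ∈ cycle → adj G u w ≡ true → w ∈ cycle
    cycle-closed u∈ uw = proj₂ (CycAdj⇒∈ (Equivalence.to (adj⇔ u∈ _) uw))

    rest-closed : Closed R → Closed rest
    rest-closed closed u∈ uw with ∈-rest⁻ u∈
    ... | u∈R , u∉ = ∈-rest⁺ (closed u∈R uw) (λ w∈ → u∉ (cycle-closed w∈ (adj-sym G uw)))

    extend : Closed R → v ∈ R → CycleDecomposition rest → CycleDecomposition R
    extend closed v∈ D = record
      { cycles   = cycle ∷ D.cycles
      ; long     = long ∷ D.long
      ; disjoint = ++⁺ distinct D.disjoint λ (u∈ , u∈D) → proj₂ (∈-rest⁻ (D.sound u∈D)) u∈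
      ; sound    = λ u∈ → Data.Sum.[ within closed v∈ , proj₁ ∘ ∈-rest⁻ ∘ D.sound ]′ (∈-++⁻ cycle u∈)
      ; complete = complete
      ; adj⇔     = adj⇔′ }
      where
      module D = CycleDecomposition D
      complete : ∀ {u} → u ∈ R → u ∈ cycle ++ concat D.cycles
      complete {u} u∈ with Any.any? (u ≟_) cycle
      ... | yes u∈C = ∈-++⁺ˡ u∈C
      ... | no  u∉C = ∈-++⁺ʳ cycle (D.complete (∈-rest⁺ u∈ u∉C))
      adj⇔′ : ∀ {u} → u ∈ R → ∀ w → (adj G u w ≡ true) ⇔ Any (λ c → CycAdj c u w) (cycle ∷ D.cycles)
      adj⇔′ {u} u∈ w with Any.any? (u ≟_) cycle
      ... | yes u∈C = mk⇔ (here ∘ Equivalence.to (adj⇔ u∈C w)) λ where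
        (here uw)   → Equivalence.from (adj⇔ u∈C w) uw
        (there uw) → ⊥-elim (proj₂ (∈-rest⁻ (D.sound (∈-concat⁺ (Any.map (proj₁ ∘ CycAdj⇒∈) uw)))) u∈C)
      ... | no  u∉C = mk⇔ (there ∘ Equivalence.to (D.adj⇔ (∈-rest⁺ u∈ u∉C) w)) λ where
        (here uw)  → ⊥-elim (u∉C (proj₁ (CycAdj⇒∈ uw)))
        (there uw) → Equivalence.from (D.adj⇔ (∈-rest⁺ u∈ u∉C) w) uw

  decompose : ∀ bound R → length R ≤ bound → Unique R → Closed R → CycleDecomposition R
  decompose _ [] _ _ _ = record
    { cycles = [] ; long = [] ; disjoint = [] ; sound = λ () ; complete = λ () ; adj⇔ = λ () }
  decompose (suc bound) R@(v ∷ _) |R|≤ uniqueR closed =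
    extend closed (here refl)
      (decompose bound rest (≤-pred (≤-trans (rest-shorter (here refl)) |R|≤))
                 (filter⁺ offCycle? uniqueR) (rest-closed closed))
    where open Remove (cycleThrough v) R

  isDisjointUnionOfCycles : IsDisjointUnionOfCycles G
  isDisjointUnionOfCycles = cycles , long , disjoint , (λ v → complete (∈-allFin v)) , (λ u w → adj⇔ (∈-allFin u) w)
    where
    allClosed : Closed (allFin n)
    allClosed _ _ = ∈-allFin _
    open CycleDecomposition (decompose n (allFin n) (≤-reflexive (length-tabulate (λ i → i))) (allFin⁺ n) allClosed)

module _ {n : ℕ} (G : SimpleGraph n) where

  ∈-subdivision-inj₂⁻ : ∀ {e} → inj₂ e ∈ vs (subdivision G) → e ∈ edgeList G
  ∈-subdivision-inj₂⁻ e∈ with ∈-++⁻ (map inj₁ (allFin n)) e∈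
  ... | inj₁ e∈₁ with ∈-map⁻ inj₁ e∈₁
  ...   | _ , _ , ()
  ∈-subdivision-inj₂⁻ e∈ | inj₂ e∈₂ with ∈-map⁻ inj₂ e∈₂
  ...   | _ , e∈′ , refl = e∈′

  subdivision-edgeRegular⇒twoRegular : ∀ {k} → 0 < k → (∀ v → degree (toListGraph G) v ≡ k) →
                                       IsEdgeRegular (subdivision G) → IsTwoRegular G
  subdivision-edgeRegular⇒twoRegular {k} k>0 regular (_ , k′ , _ , _ , regularS , _) v
    with count>0⇒∃ {xs = vs (subdivision G)} (subst (0 <_) (sym (trans (degree-inj₁ G v) (regular v))) k>0)
  ... | inj₂ e , e∈ , _ = begin
    degree (toListGraph G) v         ≡⟨ sym (degree-inj₁ G v) ⟩
    degree (subdivision G) (inj₁ v)  ≡⟨ regularS (inj₁ v) (∈-++⁺ˡ (∈-map⁺ inj₁ (∈-allFin v))) ⟩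
    k′                               ≡⟨ sym (regularS (inj₂ e) e∈) ⟩
    degree (subdivision G) (inj₂ e)  ≡⟨ degree-inj₂ G (∈-subdivision-inj₂⁻ e∈) ⟩
    2                                ∎
    where open ≡-Reasoning

  twoRegular⇒subdivision-edgeRegular : IsTwoRegular G → IsEdgeRegular (subdivision G)
  twoRegular⇒subdivision-edgeRegular twoRegular =
    length (vs (subdivision G)) , 2 , 0 , refl , degrees , λ u w _ _ → commonNbrs-subdivision G u w
    where
    degrees : ∀ u → u ∈ vs (subdivision G) → degree (subdivision G) u ≡ 2
    degrees (inj₁ v) _  = trans (degree-inj₁ G v) (twoRegular v)
    degrees (inj₂ _) e∈ = degree-inj₂ G (∈-subdivision-inj₂⁻ e∈)

  -- The second vertex v₁ of a cycle v₀ v₁ v₂ … is adjacent exactly to v₀ and v₂.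
  cycles⇒vertexOfDegree2 : ∀ cs → All (λ c → 3 ≤ length c) cs → Unique (concat cs) →
    (∀ u w → (adj G u w ≡ true) ⇔ Any (λ c → CycAdj c u w) cs) → ∀ {w} → w ∈ concat cs →
    ∃ λ v → degree (toListGraph G) v ≡ 2
  cycles⇒vertexOfDegree2 ([] ∷ _)                   (() ∷ _)
  cycles⇒vertexOfDegree2 ((_ ∷ []) ∷ _)             (s≤s () ∷ _)
  cycles⇒vertexOfDegree2 ((_ ∷ _ ∷ []) ∷ _)         (s≤s (s≤s ()) ∷ _)
  cycles⇒vertexOfDegree2 ((v₀ ∷ v₁ ∷ v₂ ∷ vs′) ∷ cs) _ (v₀∉ ∷ v₁≢ ∷ _) adj⇔ _ =
    v₁ , count≡2⁺ (allFin⁺ n) record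
      { a = v₀ ; b = v₂ ; a∈ = ∈-allFin v₀ ; b∈ = ∈-allFin v₂
      ; a≢b = All.head (All.tail v₀∉)
      ; pa = Equivalence.from (adj⇔ v₁ v₀) (here (inj₂ (here refl)))
      ; pb = Equivalence.from (adj⇔ v₁ v₂) (here (inj₁ (there (here refl))))
      ; only = λ {w} _ v₁w → neighbour w (Equivalence.to (adj⇔ v₁ w) v₁w) }
    where
    v₁∉ : v₁ ∉ (v₂ ∷ vs′) ++ concat cs
    v₁∉ v₁∈ = All.lookup v₁≢ v₁∈ refl
    neighbour : ∀ w → Any (λ c → CycAdj c v₁ w) ((v₀ ∷ v₁ ∷ v₂ ∷ vs′) ∷ cs) → w ≡ v₀ ⊎ w ≡ v₂
    neighbour w (there v₁w) =
      ⊥-elim (v₁∉ (∈-++⁺ʳ (v₂ ∷ vs′) (∈-concat⁺ (Any.map (proj₁ ∘ CycAdj⇒∈) v₁w))))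
    neighbour w (here (inj₁ (here refl)))             = ⊥-elim (All.head v₀∉ refl)
    neighbour w (here (inj₁ (there (here refl))))     = inj₂ refl
    neighbour w (here (inj₁ (there (there v₁w))))    = ⊥-elim (v₁∉ (∈-++⁺ˡ (proj₁ (∈-zip⁻ v₁w))))
    neighbour w (here (inj₂ (here refl)))             = inj₁ refl
    neighbour w (here (inj₂ (there (here refl))))     = ⊥-elim (v₁∉ (here refl))
    neighbour w (here (inj₂ (there (there wv₁)))) with ∈-++⁻ vs′ (proj₂ (∈-zip⁻ wv₁))
    ... | inj₁ v₁∈vs′      = ⊥-elim (v₁∉ (there (∈-++⁺ˡ v₁∈vs′)))
    ... | inj₂ (here refl) = ⊥-elim (All.head v₀∉ refl)

  cycles⇒twoRegular : ∀ {k} → (∀ v → degree (toListGraph G) v ≡ k) → IsDisjointUnionOfCycles G → IsTwoRegular G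
  cycles⇒twoRegular regular (cs , long , disjoint , covers , adj⇔) v
    with cycles⇒vertexOfDegree2 cs long disjoint adj⇔ (covers v)
  ... | w , deg₂ = trans (regular v) (trans (sym (regular w)) deg₂)

mainTheorem12 : (n k l : ℕ) (G : SimpleGraph n) →
    0 < k →
    EdgeRegular (toListGraph G) n k l →
    IsEdgeRegular (subdivision G) ⇔ IsDisjointUnionOfCycles G
mainTheorem12 n k l G k>0 (_ , regular , _) = mk⇔
  (TwoRegular.isDisjointUnionOfCycles G ∘ subdivision-edgeRegular⇒twoRegular G k>0 regularG)
  (twoRegular⇒subdivision-edgeRegular G ∘ cycles⇒twoRegular G regularG)
  where
  regularG : ∀ v → degree (toListGraph G) v ≡ k
  regularG v = regular v (∈-allFin v)
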